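{- For each integer $n \geq 0$, we have $T_2(n, -1) = (-1)^{t(n)} S(n + 1, -2)$, where $T_2(n,x) = \sum_{m=0}^{n} x^{\nu_2\left(\binom{n}{m}\right)}$, $t(n)$ is the $n$th term of the Thue--Morse sequence, and $S(n,x)$ is the $n$th Stern polynomial.
   Context: $\nu_2(N)$ denotes the $2$-adic valuation of a positive integer $N$ (exponent of the highest power of $2$ dividing $N$). The Thue--Morse sequence is $t(n) = $ (number of $1$s in the binary representation of $n$) $\bmod 2$. The Stern polynomial $S(n,x)$ for $n \ge 0$ is defined as follows: if $n_\ell \cdots n_1 n_0$ is the standard base-$2$ representation of $n$ (empty for $n=0$, giving the empty matrix product), then \[ S(n, x) = \begin{bmatrix} 1 & 0 \end{bmatrix} A(n_0) \, A(n_1) \, \cdots \, A(n_\ell) \begin{bmatrix} 0 \\ 1 \end{bmatrix},\quad A(0) = \begin{bmatrix} x & 0 \\ 1 & 1 \end{bmatrix},\ A(1) = \begin{bmatrix} 1 & 1 \\ 0 & x \end{bmatrix}. \] -}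

module Defs where

open import Data.Nat as ℕ using (ℕ; zero; suc; _%_; _/_)
open import Data.Nat.Combinatorics using (_C_)
open import Data.Integer as ℤ using (ℤ; +_; -_; _+_; _*_; _^_)
open import Data.List using (List; []; _∷_; map; upTo; foldr)
open import Data.Nat.ListAction using (sum)
open import Data.Bool using (Bool; true; false)

-- Base-2 digits of n, least significant first (n₀ ∷ n₁ ∷ … ∷ n_ℓ),
-- empty for n = 0.  The first argument is fuel (≥ n suffices).
bitsAux : ℕ → ℕ → List ℕ
bitsAux zero    _       = []
bitsAux (suc f) zero    = []
bitsAux (suc f) (suc m) = (suc m % 2) ∷ bitsAux f (suc m / 2)

bits : ℕ → List ℕ
bits n = bitsAux n n

-- 2-adic valuation of a positive integer (fuel n suffices since ν₂(n) < n);
-- the value at 0 is irrelevant (set to 0).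
ν₂Aux : ℕ → ℕ → ℕ
ν₂Aux zero    _ = 0
ν₂Aux (suc f) zero = 0
ν₂Aux (suc f) (suc m) with suc m % 2
... | zero  = suc (ν₂Aux f (suc m / 2))
... | suc _ = 0

ν₂ : ℕ → ℕ
ν₂ n = ν₂Aux n n

t : ℕ → ℕ
t n = sum (bits n) % 2

T₂ : ℕ → ℤ → ℤ
T₂ n x = sum' (map (λ m → x ^ ν₂ (n C m)) (upTo (suc n)))
  where
  sum' : List ℤ → ℤ
  sum' = foldr _+_ (+ 0)

record M₂ : Set where
  constructor mat
  field a b c d : ℤ

_⊗_ : M₂ → M₂ → M₂
mat a b c d ⊗ mat a' b' c' d' =
  mat (a * a' + b * c') (a * b' + b * d') (c * a' + d * c') (c * b' + d * d')

I₂ : M₂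
I₂ = mat (+ 1) (+ 0) (+ 0) (+ 1)

A : ℤ → ℕ → M₂
A x zero    = mat x (+ 0) (+ 1) (+ 1)
A x (suc _) = mat (+ 1) (+ 1) (+ 0) x

-- Stern polynomial evaluated at an integer x:
-- S(n,x) = [1 0] A(n₀) A(n₁) ⋯ A(n_ℓ) [0 1]ᵀ  = (1,2)-entry of the product
S : ℕ → ℤ → ℤ
S n x = M₂.b (foldr (λ d P → A x d ⊗ P) I₂ (bits n))

{-# OPTIONS --safe #-}
-- Kummer's theorem, ν₂(C(n,k)) = s₂(k) + s₂(n − k) − s₂(n) with s₂ the binary digit sum,
-- turns each term (−1)^ν₂(C(n,k)) into ε(n) ε(k) ε(n − k), where ε(m) = (−1)^s₂(m) is the
-- ±1 Thue–Morse sequence.  So T₂(n, −1) = ε(n) c(n + 1) for the autoconvolution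
-- c(N) = Σ_{j<N} ε(j) ε(N − 1 − j).  Splitting that sum by the parity of j and using
-- ε(2j) = ε(j), ε(2j + 1) = −ε(j) gives c(2k) = −2 c(k) and c(2k + 1) = c(k) + c(k + 1):
-- Stern's recurrences at x = −2, which together with c(0) = 0, c(1) = 1 force c(N) = S(N, −2).
module Submission where

open import Defs
open import Relation.Binary.PropositionalEquality

module BinaryExpansion where

  open import Data.Nat
  open import Data.Nat.Properties
  open import Data.Nat.DivMod
  open import Data.Nat.Induction using (<-rec)
  open import Data.Nat.Combinatorics using (_C_; k![n∸k]!∣n!)
  open import Data.Nat.Combinatorics.Specification using (nCk≡n!/k![n-k]!)
  open import Data.Nat.ListAction using (sum)
  open import Data.Nat.Tactic.RingSolver using (solve-∀)
  open import Data.List using (_∷_)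
  open import Data.Empty using (⊥-elim)
  open ≡-Reasoning

  data Binary : ℕ → Set where
    zero : Binary 0
    even : ∀ k → Binary (2 * suc k)
    odd  : ∀ k → Binary (suc (2 * k))

  1+[1+2k]≡2[1+k] : ∀ k → suc (suc (2 * k)) ≡ 2 * suc k
  1+[1+2k]≡2[1+k] k = sym (*-suc 2 k)

  binary : ∀ n → Binary n
  binary zero = zero
  binary (suc n) with binary n
  ... | zero   = odd 0
  ... | even k = odd (suc k)
  ... | odd k  = subst Binary (sym (1+[1+2k]≡2[1+k] k)) (even k)

  binaryInduction : ∀ {ℓ} (P : ℕ → Set ℓ) → P 0 →
                    (∀ k → P (suc k) → P (2 * suc k)) →
                    (∀ k → P k → P (suc (2 * k))) →
                    ∀ n → P n
  binaryInduction P p₀ p-even p-odd = <-rec P step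
    where
    step : ∀ n → (∀ {m} → m < n → P m) → P n
    step n rec with binary n
    ... | zero   = p₀
    ... | even k = p-even k (rec (s≤s (m<m+n k z<s)))
    ... | odd k  = p-odd k (rec (s≤s (m≤m+n k (k + 0))))

  [2k]%2≡0 : ∀ k → 2 * k % 2 ≡ 0
  [2k]%2≡0 k = trans (cong (_% 2) (*-comm 2 k)) (m*n%n≡0 k 2)

  [1+2k]%2≡1 : ∀ k → suc (2 * k) % 2 ≡ 1
  [1+2k]%2≡1 k = trans (cong (_% 2) (cong suc (*-comm 2 k))) ([m+kn]%n≡m%n 1 k 2)

  [2k]/2≡k : ∀ k → 2 * k / 2 ≡ k
  [2k]/2≡k k = trans (cong (_/ 2) (*-comm 2 k)) (m*n/n≡m k 2)

  [1+2k]/2≡k : ∀ k → suc (2 * k) / 2 ≡ k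
  [1+2k]/2≡k k = trans (+-distrib-/ 1 (2 * k) 1+[2k]%2<2) ([2k]/2≡k k)
    where
    1+[2k]%2<2 : 1 + 2 * k % 2 < 2
    1+[2k]%2<2 = subst (λ r → 1 + r < 2) (sym ([2k]%2≡0 k)) ≤-refl

  [1+m]/2≤m : ∀ m → suc m / 2 ≤ m
  [1+m]/2≤m m = <⇒≤pred (m/n<m (suc m) 2 ≤-refl)

  bitsAux-fuel : ∀ f g m → m ≤ f → m ≤ g → bitsAux f m ≡ bitsAux g m
  bitsAux-fuel zero    zero    zero    _       _       = refl
  bitsAux-fuel zero    (suc g) zero    _       _       = refl
  bitsAux-fuel (suc f) zero    zero    _       _       = refl
  bitsAux-fuel (suc f) (suc g) zero    _       _       = refl
  bitsAux-fuel (suc f) (suc g) (suc m) (s≤s p) (s≤s q) =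
    cong (suc m % 2 ∷_) (bitsAux-fuel f g (suc m / 2) (≤-trans ([1+m]/2≤m m) p) (≤-trans ([1+m]/2≤m m) q))

  ν₂Aux-fuel : ∀ f g m → m ≤ f → m ≤ g → ν₂Aux f m ≡ ν₂Aux g m
  ν₂Aux-fuel zero    zero    zero    _       _       = refl
  ν₂Aux-fuel zero    (suc g) zero    _       _       = refl
  ν₂Aux-fuel (suc f) zero    zero    _       _       = refl
  ν₂Aux-fuel (suc f) (suc g) zero    _       _       = refl
  ν₂Aux-fuel (suc f) (suc g) (suc m) (s≤s p) (s≤s q) with suc m % 2
  ... | zero  = cong suc (ν₂Aux-fuel f g (suc m / 2) (≤-trans ([1+m]/2≤m m) p) (≤-trans ([1+m]/2≤m m) q))
  ... | suc _ = refl

  bits-suc : ∀ m → bits (suc m) ≡ suc m % 2 ∷ bits (suc m / 2)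
  bits-suc m = cong (suc m % 2 ∷_) (bitsAux-fuel m (suc m / 2) (suc m / 2) ([1+m]/2≤m m) ≤-refl)

  bits-odd : ∀ k → bits (suc (2 * k)) ≡ 1 ∷ bits k
  bits-odd k = trans (bits-suc (2 * k)) (cong₂ _∷_ ([1+2k]%2≡1 k) (cong bits ([1+2k]/2≡k k)))

  bits-even : ∀ k → bits (2 * suc k) ≡ 0 ∷ bits (suc k)
  bits-even k = begin
    bits (2 * suc k)                            ≡⟨ cong bits (sym (1+[1+2k]≡2[1+k] k)) ⟩
    bits (suc (suc (2 * k)))                    ≡⟨ bits-suc (suc (2 * k)) ⟩
    suc (suc (2 * k)) % 2 ∷ bits (suc (suc (2 * k)) / 2)
      ≡⟨ cong (λ n → n % 2 ∷ bits (n / 2)) (1+[1+2k]≡2[1+k] k) ⟩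
    2 * suc k % 2 ∷ bits (2 * suc k / 2)        ≡⟨ cong₂ _∷_ ([2k]%2≡0 (suc k)) (cong bits ([2k]/2≡k (suc k))) ⟩
    0 ∷ bits (suc k)                            ∎

  s₂ : ℕ → ℕ
  s₂ n = sum (bits n)

  s₂-odd : ∀ k → s₂ (suc (2 * k)) ≡ suc (s₂ k)
  s₂-odd k = cong sum (bits-odd k)

  s₂-double : ∀ k → s₂ (2 * k) ≡ s₂ k
  s₂-double zero    = refl
  s₂-double (suc k) = cong sum (bits-even k)

  ν₂-odd : ∀ k → ν₂ (suc (2 * k)) ≡ 0
  ν₂-odd k rewrite [1+2k]%2≡1 k = refl

  ν₂-double : ∀ n .{{_ : NonZero n}} → ν₂ (2 * n) ≡ suc (ν₂ n)
  ν₂-double (suc k) = begin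
    ν₂ (2 * suc k)                   ≡⟨ cong ν₂ (sym (1+[1+2k]≡2[1+k] k)) ⟩
    ν₂ (suc (suc (2 * k)))           ≡⟨ ν₂-suc-even (suc (2 * k)) (trans (cong (_% 2) (1+[1+2k]≡2[1+k] k)) ([2k]%2≡0 (suc k))) ⟩
    suc (ν₂ (suc (suc (2 * k)) / 2)) ≡⟨ cong (λ n → suc (ν₂ (n / 2))) (1+[1+2k]≡2[1+k] k) ⟩
    suc (ν₂ (2 * suc k / 2))         ≡⟨ cong (λ m → suc (ν₂ m)) ([2k]/2≡k (suc k)) ⟩
    suc (ν₂ (suc k))                 ∎
    where
    ν₂-suc-even : ∀ m → suc m % 2 ≡ 0 → ν₂ (suc m) ≡ suc (ν₂ (suc m / 2))
    ν₂-suc-even m e rewrite e = cong suc (ν₂Aux-fuel m (suc m / 2) (suc m / 2) ([1+m]/2≤m m) ≤-refl)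

  ν₂-odd*n : ∀ k n → ν₂ (suc (2 * k) * n) ≡ ν₂ n
  ν₂-odd*n k = binaryInduction (λ n → ν₂ (a * n) ≡ ν₂ n) (cong ν₂ (*-zeroʳ a)) even-case odd-case
    where
    a : ℕ
    a = suc (2 * k)
    even-case : ∀ j → ν₂ (a * suc j) ≡ ν₂ (suc j) → ν₂ (a * (2 * suc j)) ≡ ν₂ (2 * suc j)
    even-case j ih = begin
      ν₂ (a * (2 * suc j)) ≡⟨ cong ν₂ (x*[2y]≡2[x*y] a (suc j)) ⟩
      ν₂ (2 * (a * suc j)) ≡⟨ ν₂-double (a * suc j) ⟩
      suc (ν₂ (a * suc j)) ≡⟨ cong suc ih ⟩
      suc (ν₂ (suc j))     ≡⟨ ν₂-double (suc j) ⟨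
      ν₂ (2 * suc j)       ∎
      where
      x*[2y]≡2[x*y] : ∀ x y → x * (2 * y) ≡ 2 * (x * y)
      x*[2y]≡2[x*y] = solve-∀
    odd-case : ∀ j → ν₂ (a * j) ≡ ν₂ j → ν₂ (a * suc (2 * j)) ≡ ν₂ (suc (2 * j))
    odd-case j _ = begin
      ν₂ (a * suc (2 * j))               ≡⟨ cong ν₂ (odd*odd k j) ⟩
      ν₂ (suc (2 * (k + j + 2 * k * j))) ≡⟨ ν₂-odd (k + j + 2 * k * j) ⟩
      0                                  ≡⟨ ν₂-odd j ⟨
      ν₂ (suc (2 * j))                   ∎
      where
      odd*odd : ∀ k j → suc (2 * k) * suc (2 * j) ≡ suc (2 * (k + j + 2 * k * j))
      odd*odd = solve-∀

  ν₂-* : ∀ m n .{{_ : NonZero m}} .{{_ : NonZero n}} → ν₂ (m * n) ≡ ν₂ m + ν₂ n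
  ν₂-* m n = binaryInduction P (λ {{0≢0}} → ⊥-elim (≢-nonZero⁻¹ 0 {{0≢0}} refl)) even-case odd-case m
    where
    P : ℕ → Set
    P m = .{{_ : NonZero m}} → ν₂ (m * n) ≡ ν₂ m + ν₂ n
    even-case : ∀ j → P (suc j) → P (2 * suc j)
    even-case j ih = begin
      ν₂ (2 * suc j * n)            ≡⟨ cong ν₂ (*-assoc 2 (suc j) n) ⟩
      ν₂ (2 * (suc j * n))          ≡⟨ ν₂-double (suc j * n) {{m*n≢0 (suc j) n}} ⟩
      suc (ν₂ (suc j * n))          ≡⟨ cong suc ih ⟩
      suc (ν₂ (suc j) + ν₂ n)       ≡⟨ cong (_+ ν₂ n) (ν₂-double (suc j)) ⟨
      ν₂ (2 * suc j) + ν₂ n         ∎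
    odd-case : ∀ k → P k → P (suc (2 * k))
    odd-case k _ = trans (ν₂-odd*n k n) (cong (_+ ν₂ n) (sym (ν₂-odd k)))

  -- Adding 1 to n turns its ν₂(n + 1) trailing ones into zeros and one zero into a one.
  s₂-suc+ν₂-suc : ∀ n → s₂ (suc n) + ν₂ (suc n) ≡ suc (s₂ n)
  s₂-suc+ν₂-suc = binaryInduction P refl even-case odd-case
    where
    P : ℕ → Set
    P n = s₂ (suc n) + ν₂ (suc n) ≡ suc (s₂ n)
    even-case : ∀ k → P (suc k) → P (2 * suc k)
    even-case k _ = begin
      s₂ (suc (2 * suc k)) + ν₂ (suc (2 * suc k)) ≡⟨ cong₂ _+_ (s₂-odd (suc k)) (ν₂-odd (suc k)) ⟩
      suc (s₂ (suc k)) + 0                        ≡⟨ +-identityʳ _ ⟩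
      suc (s₂ (suc k))                            ≡⟨ cong suc (s₂-double (suc k)) ⟨
      suc (s₂ (2 * suc k))                        ∎
    odd-case : ∀ k → P k → P (suc (2 * k))
    odd-case k ih = begin
      s₂ (suc (suc (2 * k))) + ν₂ (suc (suc (2 * k))) ≡⟨ cong (λ n → s₂ n + ν₂ n) (1+[1+2k]≡2[1+k] k) ⟩
      s₂ (2 * suc k) + ν₂ (2 * suc k)                 ≡⟨ cong₂ _+_ (s₂-double (suc k)) (ν₂-double (suc k)) ⟩
      s₂ (suc k) + suc (ν₂ (suc k))                   ≡⟨ +-suc _ _ ⟩
      suc (s₂ (suc k) + ν₂ (suc k))                   ≡⟨ cong suc ih ⟩
      suc (suc (s₂ k))                                ≡⟨ cong suc (s₂-odd k) ⟨
      suc (s₂ (suc (2 * k)))                          ∎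

  legendre : ∀ n → ν₂ (n !) + s₂ n ≡ n
  legendre zero    = refl
  legendre (suc n) = begin
    ν₂ (suc n * n !) + s₂ (suc n)            ≡⟨ cong (_+ s₂ (suc n)) (ν₂-* (suc n) (n !) {{_}} {{n !≢0}}) ⟩
    ν₂ (suc n) + ν₂ (n !) + s₂ (suc n)       ≡⟨ regroup (ν₂ (suc n)) (ν₂ (n !)) (s₂ (suc n)) ⟩
    ν₂ (n !) + (s₂ (suc n) + ν₂ (suc n))     ≡⟨ cong (ν₂ (n !) +_) (s₂-suc+ν₂-suc n) ⟩
    ν₂ (n !) + suc (s₂ n)                    ≡⟨ +-suc _ _ ⟩
    suc (ν₂ (n !) + s₂ n)                    ≡⟨ cong suc (legendre n) ⟩
    suc n                                    ∎
    where
    regroup : ∀ a b c → a + b + c ≡ b + (c + a)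
    regroup = solve-∀

  nCk*k!*[n∸k]!≡n! : ∀ {n k} → k ≤ n → (n C k) * (k ! * (n ∸ k) !) ≡ n !
  nCk*k!*[n∸k]!≡n! {n} {k} k≤n = begin
    (n C k) * (k ! * (n ∸ k) !)                    ≡⟨ cong (_* (k ! * (n ∸ k) !)) (nCk≡n!/k![n-k]! k≤n) ⟩
    n ! / (k ! * (n ∸ k) !) * (k ! * (n ∸ k) !)    ≡⟨ m/n*n≡m (k![n∸k]!∣n! k≤n) ⟩
    n !                                            ∎
    where instance _ = k !* (n ∸ k) !≢0

  nCk≢0 : ∀ {n k} → k ≤ n → NonZero (n C k)
  nCk≢0 {n} {k} k≤n = m*n≢0⇒m≢0 (n C k) {{subst NonZero (sym (nCk*k!*[n∸k]!≡n! k≤n)) (n !≢0)}}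

  kummer : ∀ {n k} → k ≤ n → ν₂ (n C k) + s₂ n ≡ s₂ k + s₂ (n ∸ k)
  kummer {n} {k} k≤n = +-cancelˡ-≡ (ν₂ (k !) + ν₂ ((n ∸ k) !)) _ _ (begin
    ν₂ (k !) + ν₂ ((n ∸ k) !) + (ν₂ (n C k) + s₂ n) ≡⟨ regroup₁ (ν₂ (n C k)) (ν₂ (k !)) (ν₂ ((n ∸ k) !)) (s₂ n) ⟩
    ν₂ (n C k) + (ν₂ (k !) + ν₂ ((n ∸ k) !)) + s₂ n ≡⟨ cong (_+ s₂ n) ν₂-product ⟨
    ν₂ ((n C k) * (k ! * (n ∸ k) !)) + s₂ n         ≡⟨ cong (λ m → ν₂ m + s₂ n) (nCk*k!*[n∸k]!≡n! k≤n) ⟩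
    ν₂ (n !) + s₂ n                                 ≡⟨ legendre n ⟩
    n                                               ≡⟨ m+[n∸m]≡n k≤n ⟨
    k + (n ∸ k)                                     ≡⟨ cong₂ _+_ (legendre k) (legendre (n ∸ k)) ⟨
    ν₂ (k !) + s₂ k + (ν₂ ((n ∸ k) !) + s₂ (n ∸ k)) ≡⟨ regroup₂ (ν₂ (k !)) (s₂ k) (ν₂ ((n ∸ k) !)) (s₂ (n ∸ k)) ⟩
    ν₂ (k !) + ν₂ ((n ∸ k) !) + (s₂ k + s₂ (n ∸ k)) ∎)
    where
    instance
      _ = nCk≢0 k≤n
      _ = k !* (n ∸ k) !≢0
      _ = k !≢0
      _ = (n ∸ k) !≢0
    ν₂-product : ν₂ ((n C k) * (k ! * (n ∸ k) !)) ≡ ν₂ (n C k) + (ν₂ (k !) + ν₂ ((n ∸ k) !))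
    ν₂-product = trans (ν₂-* (n C k) _) (cong (ν₂ (n C k) +_) (ν₂-* (k !) ((n ∸ k) !)))
    regroup₁ : ∀ c a b s → a + b + (c + s) ≡ c + (a + b) + s
    regroup₁ = solve-∀
    regroup₂ : ∀ a s b t → a + s + (b + t) ≡ a + b + (s + t)
    regroup₂ = solve-∀

open BinaryExpansion using (binaryInduction; 1+[1+2k]≡2[1+k]; s₂; s₂-odd; s₂-double; bits-odd; bits-even; kummer)
open import Data.Nat as ℕ using (ℕ; zero; suc; _∸_; _<_; _%_; _/_)
import Data.Nat.Properties as ℕP
import Data.Nat.Tactic.RingSolver as ℕ-Solver
open import Data.Nat.DivMod using (m≡m%n+[m/n]*n)
open import Data.Nat.Combinatorics using (_C_)
open import Data.Integer using (ℤ; +_; -_; _+_; _*_; _^_; -1ℤ; 0ℤ; 1ℤ)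
open import Data.Integer.Properties using (^-distribˡ-+-*; ^-*-assoc; ^-zeroˡ; *-identityʳ; *-zeroʳ; *-assoc; *-distribˡ-+; +-comm; +-assoc)
open import Data.Integer.Tactic.RingSolver using (solve-∀)
open import Data.List using (foldr; map; applyUpTo)
open import Data.Product using (_×_; _,_; proj₁)
open ≡-Reasoning

-1ℤ^[m+2n]≡-1ℤ^m : ∀ m n → -1ℤ ^ (m ℕ.+ 2 ℕ.* n) ≡ -1ℤ ^ m
-1ℤ^[m+2n]≡-1ℤ^m m n = begin
  -1ℤ ^ (m ℕ.+ 2 ℕ.* n)      ≡⟨ ^-distribˡ-+-* -1ℤ m (2 ℕ.* n) ⟩
  -1ℤ ^ m * -1ℤ ^ (2 ℕ.* n)  ≡⟨ cong (-1ℤ ^ m *_) (trans (sym (^-*-assoc -1ℤ 2 n)) (^-zeroˡ n)) ⟩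
  -1ℤ ^ m * 1ℤ               ≡⟨ *-identityʳ (-1ℤ ^ m) ⟩
  -1ℤ ^ m                    ∎

-1ℤ^[n%2]≡-1ℤ^n : ∀ n → -1ℤ ^ (n % 2) ≡ -1ℤ ^ n
-1ℤ^[n%2]≡-1ℤ^n n = begin
  -1ℤ ^ (n % 2)                     ≡⟨ -1ℤ^[m+2n]≡-1ℤ^m (n % 2) (n / 2) ⟨
  -1ℤ ^ (n % 2 ℕ.+ 2 ℕ.* (n / 2))   ≡⟨ cong (λ m → -1ℤ ^ (n % 2 ℕ.+ m)) (ℕP.*-comm 2 (n / 2)) ⟩
  -1ℤ ^ (n % 2 ℕ.+ n / 2 ℕ.* 2)     ≡⟨ cong (-1ℤ ^_) (m≡m%n+[m/n]*n n 2) ⟨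
  -1ℤ ^ n                           ∎

-1ℤ^-transpose : ∀ a b {c} → a ℕ.+ b ≡ c → -1ℤ ^ a ≡ -1ℤ ^ b * -1ℤ ^ c
-1ℤ^-transpose a b {c} a+b≡c = begin
  -1ℤ ^ a                  ≡⟨ -1ℤ^[m+2n]≡-1ℤ^m a b ⟨
  -1ℤ ^ (a ℕ.+ 2 ℕ.* b)    ≡⟨ cong (-1ℤ ^_) (trans (rearrange a b) (cong (b ℕ.+_) a+b≡c)) ⟩
  -1ℤ ^ (b ℕ.+ c)          ≡⟨ ^-distribˡ-+-* -1ℤ b c ⟩
  -1ℤ ^ b * -1ℤ ^ c        ∎
  where
  rearrange : ∀ a b → a ℕ.+ 2 ℕ.* b ≡ b ℕ.+ (a ℕ.+ b)
  rearrange = ℕ-Solver.solve-∀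

∑ : ℕ → (ℕ → ℤ) → ℤ
∑ zero    f = 0ℤ
∑ (suc N) f = ∑ N f + f N

∑-cong : ∀ N {f g : ℕ → ℤ} → (∀ j → j < N → f j ≡ g j) → ∑ N f ≡ ∑ N g
∑-cong zero    f≗g = refl
∑-cong (suc N) f≗g = cong₂ _+_ (∑-cong N (λ j j<N → f≗g j (ℕP.m<n⇒m<1+n j<N))) (f≗g N ℕP.≤-refl)

∑-scale : ∀ N c (f : ℕ → ℤ) → ∑ N (λ j → c * f j) ≡ c * ∑ N f
∑-scale zero    c f = sym (*-zeroʳ c)
∑-scale (suc N) c f = trans (cong (_+ c * f N) (∑-scale N c f)) (sym (*-distribˡ-+ c (∑ N f) (f N)))

∑-cons : ∀ N (f : ℕ → ℤ) → ∑ (suc N) f ≡ f 0 + ∑ N (λ j → f (suc j))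
∑-cons zero    f = +-comm 0ℤ (f 0)
∑-cons (suc N) f = trans (cong (_+ f (suc N)) (∑-cons N f)) (+-assoc (f 0) _ _)

∑-even+odd : ∀ N (f : ℕ → ℤ) → ∑ (2 ℕ.* N) f ≡ ∑ N (λ j → f (2 ℕ.* j)) + ∑ N (λ j → f (suc (2 ℕ.* j)))
∑-even+odd zero    f = refl
∑-even+odd (suc N) f = begin
  ∑ (2 ℕ.* suc N) f                                   ≡⟨ cong (λ M → ∑ M f) (1+[1+2k]≡2[1+k] N) ⟨
  ∑ (2 ℕ.* N) f + f (2 ℕ.* N) + f (suc (2 ℕ.* N))     ≡⟨ cong (λ s → s + f (2 ℕ.* N) + f (suc (2 ℕ.* N))) (∑-even+odd N f) ⟩
  E + O + f (2 ℕ.* N) + f (suc (2 ℕ.* N))             ≡⟨ interleave E O (f (2 ℕ.* N)) (f (suc (2 ℕ.* N))) ⟩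
  E + f (2 ℕ.* N) + (O + f (suc (2 ℕ.* N)))           ∎
  where
  E O : ℤ
  E = ∑ N (λ j → f (2 ℕ.* j))
  O = ∑ N (λ j → f (suc (2 ℕ.* j)))
  interleave : ∀ a b c d → a + b + c + d ≡ a + c + (b + d)
  interleave = solve-∀

foldr-+-map-applyUpTo : ∀ N (f : ℕ → ℤ) (g : ℕ → ℕ) → foldr _+_ 0ℤ (map f (applyUpTo g N)) ≡ ∑ N (λ j → f (g j))
foldr-+-map-applyUpTo zero    f g = refl
foldr-+-map-applyUpTo (suc N) f g =
  trans (cong (λ s → f (g 0) + s) (foldr-+-map-applyUpTo N f (λ j → g (suc j)))) (sym (∑-cons N (λ j → f (g j))))

ε : ℕ → ℤ
ε n = -1ℤ ^ s₂ n

ε-double : ∀ k → ε (2 ℕ.* k) ≡ ε k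
ε-double k = cong (-1ℤ ^_) (s₂-double k)

ε-odd : ∀ k → ε (suc (2 ℕ.* k)) ≡ -1ℤ * ε k
ε-odd k = cong (-1ℤ ^_) (s₂-odd k)

-1ℤ^ν₂[nCk] : ∀ {n k} → k ℕ.≤ n → -1ℤ ^ ν₂ (n C k) ≡ ε n * (ε k * ε (n ∸ k))
-1ℤ^ν₂[nCk] {n} {k} k≤n =
  trans (-1ℤ^-transpose (ν₂ (n C k)) (s₂ n) (kummer k≤n)) (cong (ε n *_) (^-distribˡ-+-* -1ℤ (s₂ k) (s₂ (n ∸ k))))

ε∗ε : ℕ → ℤ
ε∗ε N = ∑ N (λ j → ε j * ε (N ∸ suc j))

2k∸[1+2j]≡1+2[k∸[1+j]] : ∀ {j k} → j < k → 2 ℕ.* k ∸ suc (2 ℕ.* j) ≡ suc (2 ℕ.* (k ∸ suc j))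
2k∸[1+2j]≡1+2[k∸[1+j]] {j} {k} j<k = begin
  2 ℕ.* k ∸ suc (2 ℕ.* j)                                ≡⟨ cong (λ m → 2 ℕ.* m ∸ suc (2 ℕ.* j)) (ℕP.m+[n∸m]≡n j<k) ⟨
  2 ℕ.* (suc j ℕ.+ r) ∸ suc (2 ℕ.* j)                    ≡⟨ cong (_∸ suc (2 ℕ.* j)) (expand j r) ⟩
  suc (2 ℕ.* j) ℕ.+ suc (2 ℕ.* r) ∸ suc (2 ℕ.* j)        ≡⟨ ℕP.m+n∸m≡n (suc (2 ℕ.* j)) _ ⟩
  suc (2 ℕ.* r)                                          ∎
  where
  r : ℕ
  r = k ∸ suc j
  expand : ∀ j r → 2 ℕ.* (suc j ℕ.+ r) ≡ suc (2 ℕ.* j) ℕ.+ suc (2 ℕ.* r)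
  expand = ℕ-Solver.solve-∀

2k∸[2+2j]≡2[k∸[1+j]] : ∀ j k → 2 ℕ.* k ∸ suc (suc (2 ℕ.* j)) ≡ 2 ℕ.* (k ∸ suc j)
2k∸[2+2j]≡2[k∸[1+j]] j k = trans (cong (2 ℕ.* k ∸_) (1+[1+2k]≡2[1+k] j)) (sym (ℕP.*-distribˡ-∸ 2 k (suc j)))

ε∗ε-odd : ∀ k → ε∗ε (suc (2 ℕ.* k)) ≡ ε∗ε k + ε∗ε (suc k)
ε∗ε-odd k = begin
  ∑ (2 ℕ.* k) h + h (2 ℕ.* k)                                    ≡⟨ cong₂ _+_ (∑-even+odd k h) (h-even k) ⟩
  ∑ k (λ j → h (2 ℕ.* j)) + ∑ k (λ j → h (suc (2 ℕ.* j))) + u k   ≡⟨ cong (_+ u k) (cong₂ _+_ (∑-cong k (λ j _ → h-even j)) (∑-cong k h-odd)) ⟩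
  ∑ k u + ε∗ε k + u k                                            ≡⟨ swap (∑ k u) (ε∗ε k) (u k) ⟩
  ε∗ε k + (∑ k u + u k)                                          ∎
  where
  h u : ℕ → ℤ
  h j = ε j * ε (2 ℕ.* k ∸ j)
  u j = ε j * ε (k ∸ j)
  h-even : ∀ j → h (2 ℕ.* j) ≡ u j
  h-even j = cong₂ _*_ (ε-double j) (trans (cong ε (sym (ℕP.*-distribˡ-∸ 2 k j))) (ε-double (k ∸ j)))
  h-odd : ∀ j → j < k → h (suc (2 ℕ.* j)) ≡ ε j * ε (k ∸ suc j)
  h-odd j j<k = begin
    ε (suc (2 ℕ.* j)) * ε (2 ℕ.* k ∸ suc (2 ℕ.* j))     ≡⟨ cong (λ m → ε (suc (2 ℕ.* j)) * ε m) (2k∸[1+2j]≡1+2[k∸[1+j]] j<k) ⟩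
    ε (suc (2 ℕ.* j)) * ε (suc (2 ℕ.* (k ∸ suc j)))     ≡⟨ cong₂ _*_ (ε-odd j) (ε-odd (k ∸ suc j)) ⟩
    -1ℤ * ε j * (-1ℤ * ε (k ∸ suc j))                   ≡⟨ signs (ε j) (ε (k ∸ suc j)) ⟩
    ε j * ε (k ∸ suc j)                                 ∎
    where
    signs : ∀ a b → -1ℤ * a * (-1ℤ * b) ≡ a * b
    signs = solve-∀
  swap : ∀ a b c → a + b + c ≡ b + (a + c)
  swap = solve-∀

ε∗ε-double : ∀ k → ε∗ε (2 ℕ.* k) ≡ - + 2 * ε∗ε k
ε∗ε-double k = begin
  ∑ (2 ℕ.* k) h                                                 ≡⟨ ∑-even+odd k h ⟩
  ∑ k (λ j → h (2 ℕ.* j)) + ∑ k (λ j → h (suc (2 ℕ.* j)))       ≡⟨ cong₂ _+_ (∑-cong k h-even) (∑-cong k (λ j _ → h-odd j)) ⟩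
  ∑ k (λ j → -1ℤ * w j) + ∑ k (λ j → -1ℤ * w j)                 ≡⟨ cong₂ _+_ (∑-scale k -1ℤ w) (∑-scale k -1ℤ w) ⟩
  -1ℤ * ε∗ε k + -1ℤ * ε∗ε k                                     ≡⟨ double (ε∗ε k) ⟩
  - + 2 * ε∗ε k                                                 ∎
  where
  h w : ℕ → ℤ
  h j = ε j * ε (2 ℕ.* k ∸ suc j)
  w j = ε j * ε (k ∸ suc j)
  h-even : ∀ j → j < k → h (2 ℕ.* j) ≡ -1ℤ * w j
  h-even j j<k = begin
    ε (2 ℕ.* j) * ε (2 ℕ.* k ∸ suc (2 ℕ.* j))   ≡⟨ cong₂ _*_ (ε-double j) (cong ε (2k∸[1+2j]≡1+2[k∸[1+j]] j<k)) ⟩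
    ε j * ε (suc (2 ℕ.* (k ∸ suc j)))           ≡⟨ cong (ε j *_) (ε-odd (k ∸ suc j)) ⟩
    ε j * (-1ℤ * ε (k ∸ suc j))                 ≡⟨ pull (ε j) (ε (k ∸ suc j)) ⟩
    -1ℤ * w j                                   ∎
    where
    pull : ∀ a b → a * (-1ℤ * b) ≡ -1ℤ * (a * b)
    pull = solve-∀
  h-odd : ∀ j → h (suc (2 ℕ.* j)) ≡ -1ℤ * w j
  h-odd j = begin
    ε (suc (2 ℕ.* j)) * ε (2 ℕ.* k ∸ suc (suc (2 ℕ.* j))) ≡⟨ cong₂ _*_ (ε-odd j) (cong ε (2k∸[2+2j]≡2[k∸[1+j]] j k)) ⟩
    -1ℤ * ε j * ε (2 ℕ.* (k ∸ suc j))                     ≡⟨ cong (-1ℤ * ε j *_) (ε-double (k ∸ suc j)) ⟩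
    -1ℤ * ε j * ε (k ∸ suc j)                             ≡⟨ *-assoc -1ℤ (ε j) (ε (k ∸ suc j)) ⟩
    -1ℤ * w j                                             ∎
  double : ∀ a → -1ℤ * a + -1ℤ * a ≡ - + 2 * a
  double = solve-∀

record SternRecurrence (x : ℤ) (f : ℕ → ℤ) : Set where
  field
    at-0      : f 0 ≡ 0ℤ
    at-1      : f 1 ≡ 1ℤ
    at-double : ∀ k → f (2 ℕ.* suc k) ≡ x * f (suc k)
    at-odd    : ∀ k → f (suc (2 ℕ.* k)) ≡ f k + f (suc k)

sternRecurrence-unique : ∀ {x f g} → SternRecurrence x f → SternRecurrence x g → ∀ n → f n ≡ g n
sternRecurrence-unique {x} {f} {g} F G n = proj₁ (binaryInduction P base even-case odd-case n)
  where
  module F = SternRecurrence F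
  module G = SternRecurrence G
  P : ℕ → Set
  P n = f n ≡ g n × f (suc n) ≡ g (suc n)
  base : P 0
  base = trans F.at-0 (sym G.at-0) , trans F.at-1 (sym G.at-1)
  double : ∀ k → f (suc k) ≡ g (suc k) → f (2 ℕ.* suc k) ≡ g (2 ℕ.* suc k)
  double k e = trans (F.at-double k) (trans (cong (x *_) e) (sym (G.at-double k)))
  odd : ∀ k → f k ≡ g k → f (suc k) ≡ g (suc k) → f (suc (2 ℕ.* k)) ≡ g (suc (2 ℕ.* k))
  odd k e e′ = trans (F.at-odd k) (trans (cong₂ _+_ e e′) (sym (G.at-odd k)))
  even-case : ∀ k → P (suc k) → P (2 ℕ.* suc k)
  even-case k (e , e′) = double k e , odd (suc k) e e′
  odd-case : ∀ k → P k → P (suc (2 ℕ.* k))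
  odd-case k (e , e′) = odd k e e′ , subst (λ m → f m ≡ g m) (sym (1+[1+2k]≡2[1+k] k)) (double k e′)

sternMatrix : ℤ → ℕ → M₂
sternMatrix x n = foldr (λ d P → A x d ⊗ P) I₂ (bits n)

sternMatrix-odd : ∀ x k → sternMatrix x (suc (2 ℕ.* k)) ≡ A x 1 ⊗ sternMatrix x k
sternMatrix-odd x k = cong (foldr (λ d P → A x d ⊗ P) I₂) (bits-odd k)

sternMatrix-even : ∀ x k → sternMatrix x (2 ℕ.* suc k) ≡ A x 0 ⊗ sternMatrix x (suc k)
sternMatrix-even x k = cong (foldr (λ d P → A x d ⊗ P) I₂) (bits-even k)

sternMatrix-d : ∀ x n → M₂.d (sternMatrix x n) ≡ S (suc n) x
sternMatrix-d x = binaryInduction P refl even-case odd-case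
  where
  P : ℕ → Set
  P n = M₂.d (sternMatrix x n) ≡ S (suc n) x
  even-case : ∀ k → P (suc k) → P (2 ℕ.* suc k)
  even-case k _ = trans (cong M₂.d (sternMatrix-even x k)) (sym (cong M₂.b (sternMatrix-odd x (suc k))))
  odd-case : ∀ k → P k → P (suc (2 ℕ.* k))
  odd-case k ih = begin
    M₂.d (sternMatrix x (suc (2 ℕ.* k)))        ≡⟨ cong M₂.d (sternMatrix-odd x k) ⟩
    0ℤ * M₂.b Pₖ + x * M₂.d Pₖ                  ≡⟨ cong (λ s → 0ℤ * M₂.b Pₖ + x * s) ih ⟩
    0ℤ * M₂.b Pₖ + x * S (suc k) x              ≡⟨ drop-zeros (M₂.b Pₖ) x (S (suc k) x) (M₂.d Pₖ₊₁) ⟩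
    x * S (suc k) x + 0ℤ * M₂.d Pₖ₊₁            ≡⟨ cong M₂.b (sternMatrix-even x k) ⟨
    S (2 ℕ.* suc k) x                           ≡⟨ cong (λ m → S m x) (1+[1+2k]≡2[1+k] k) ⟨
    S (suc (suc (2 ℕ.* k))) x                   ∎
    where
    Pₖ Pₖ₊₁ : M₂
    Pₖ = sternMatrix x k
    Pₖ₊₁ = sternMatrix x (suc k)
    drop-zeros : ∀ a x y z → 0ℤ * a + x * y ≡ x * y + 0ℤ * z
    drop-zeros = solve-∀

S-sternRecurrence : ∀ x → SternRecurrence x (λ n → S n x)
S-sternRecurrence x = record
  { at-0      = refl
  ; at-1      = refl
  ; at-double = λ k → trans (cong M₂.b (sternMatrix-even x k)) (drop-zero x (S (suc k) x) (M₂.d (sternMatrix x (suc k))))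
  ; at-odd    = λ k → begin
      S (suc (2 ℕ.* k)) x                          ≡⟨ cong M₂.b (sternMatrix-odd x k) ⟩
      1ℤ * S k x + 1ℤ * M₂.d (sternMatrix x k)     ≡⟨ cong (λ s → 1ℤ * S k x + 1ℤ * s) (sternMatrix-d x k) ⟩
      1ℤ * S k x + 1ℤ * S (suc k) x                ≡⟨ drop-ones (S k x) (S (suc k) x) ⟩
      S k x + S (suc k) x                          ∎
  }
  where
  drop-zero : ∀ x a b → x * a + 0ℤ * b ≡ x * a
  drop-zero = solve-∀
  drop-ones : ∀ a b → 1ℤ * a + 1ℤ * b ≡ a + b
  drop-ones = solve-∀

ε∗ε-sternRecurrence : SternRecurrence (- + 2) ε∗ε
ε∗ε-sternRecurrence = record
  { at-0      = refl
  ; at-1      = refl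
  ; at-double = λ k → ε∗ε-double (suc k)
  ; at-odd    = ε∗ε-odd
  }

theorem2 : (n : ℕ) → T₂ n (- + 1) ≡ (- + 1) ^ t n * S (suc n) (- + 2)
theorem2 n = begin
  T₂ n -1ℤ                                          ≡⟨ foldr-+-map-applyUpTo (suc n) (λ k → -1ℤ ^ ν₂ (n C k)) (λ k → k) ⟩
  ∑ (suc n) (λ k → -1ℤ ^ ν₂ (n C k))                ≡⟨ ∑-cong (suc n) (λ k k<1+n → -1ℤ^ν₂[nCk] (ℕP.≤-pred k<1+n)) ⟩
  ∑ (suc n) (λ k → ε n * (ε k * ε (n ∸ k)))         ≡⟨ ∑-scale (suc n) (ε n) (λ k → ε k * ε (n ∸ k)) ⟩
  ε n * ε∗ε (suc n)                                 ≡⟨ cong₂ _*_ (sym (-1ℤ^[n%2]≡-1ℤ^n (s₂ n))) stern ⟩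
  -1ℤ ^ t n * S (suc n) (- + 2)                     ∎
  where
  stern : ε∗ε (suc n) ≡ S (suc n) (- + 2)
  stern = sternRecurrence-unique ε∗ε-sternRecurrence (S-sternRecurrence (- + 2)) (suc n)
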